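{- There is an absolute constant $C$ such that the following holds. Let $k\ge 0$ be an integer and let $G=(V,E)$ be a graph on $n$ vertices that has a $2$-valid edge coloring using at least $n-k$ colors, and such that $G$ contains no two adjacent vertices $u,v$ with $d(u)=d(v)=2$. Then $|V(G)|\le Ck$, i.e. $|V(G)|=O(k)$.
   Context: All graphs are finite, simple and undirected; $d(x)$ denotes the degree of $x$ in $G$. An edge coloring of $G$ using $m$ colors is a surjective map $c:E\to[m]$. For $v\in V$ let $F_v$ be the set of edges incident to $v$. The coloring $c$ is $2$-valid if the edges of $F_v$ receive at most $2$ distinct colors, for every $v\in V$. -}

module Defs where

open import Data.Nat using (ℕ; _+_)
open import Data.Fin using (Fin)
open import Data.Bool using (Bool; true; false; if_then_else_)
open import Data.List using (List; map; allFin)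
open import Data.Nat.ListAction using (sum)
open import Data.Empty using (⊥)
open import Data.Product using (Σ; ∃; _×_; _,_)
open import Data.Sum using (_⊎_)
open import Relation.Binary.PropositionalEquality using (_≡_)

record Graph (n : ℕ) : Set where
  field
    adj       : Fin n → Fin n → Bool
    adj-sym   : ∀ u v → adj u v ≡ adj v u
    adj-irrefl : ∀ v → adj v v ≡ false
open Graph public

Adj : ∀ {n} → Graph n → Fin n → Fin n → Set
Adj G u v = adj G u v ≡ true

degree : ∀ {n} → Graph n → Fin n → ℕ
degree {n} G v = sum (map (λ u → if adj G v u then 1 else 0) (allFin n))

-- An edge colouring with m colours: a colour for each edge {u,v},
-- represented by a function on ordered pairs that is symmetric on edges
-- (values on non-edges are irrelevant), and surjective onto Fin m.
record EdgeColoring {n} (G : Graph n) (m : ℕ) : Set where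
  field
    col       : Fin n → Fin n → Fin m
    col-sym   : ∀ u v → Adj G u v → col u v ≡ col v u
    col-surj  : ∀ (j : Fin m) → Σ (Fin n) λ u → Σ (Fin n) λ v → Adj G u v × col u v ≡ j
open EdgeColoring public

TwoValid : ∀ {n} {G : Graph n} {m} → EdgeColoring G m → Set
TwoValid {n} {G} {m} c =
  ∀ (v : Fin n) → Σ (Fin m) λ a → Σ (Fin m) λ b →
    ∀ (u : Fin n) → Adj G v u → (col c v u ≡ a ⊎ col c v u ≡ b)

NoAdjacentDeg2 : ∀ {n} → Graph n → Set
NoAdjacentDeg2 {n} G =
  ∀ (u v : Fin n) → Adj G u v → degree G u ≡ 2 → degree G v ≡ 2 → ⊥

-- Fix a representative edge for every colour.  Each vertex has two colour
-- slots (its palette); a slot is occupied when the vertex is an end of the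
-- representative edge of the colour in it.  A vertex is full when both of its
-- slots are occupied and deficient otherwise; let D count deficient vertices.
-- (1) The 2m ends of representative edges occupy distinct slots and every
--     deficient vertex has a free slot, so 2m + D ≤ 2n.
-- (2) A stray neighbour (one not joined by a representative edge) of a full
--     vertex is deficient; a full vertex without one has degree 2.  Hence,
--     using the degree-2 hypothesis, every vertex is reached from a deficient
--     vertex by a route of at most two coded steps, so n ≤ 21·D.  With n − k ≤ m they give D ≤ 2k, n ≤ 42k.
module Submission where

open import Defs
open import Data.Nat using (ℕ; _*_; _∸_; _≤_)
open import Data.Product using (Σ; _×_)

open import Data.Nat using (suc; _+_; z≤n)
open import Data.Nat.Properties
  using (≤-antisym; ≤-trans; m≤n+m∸n; +-monoʳ-≤; *-monoˡ-≤; +-cancelˡ-≤; *-distribʳ-+; +-comm; *-assoc; *-comm; module ≤-Reasoning)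
open import Data.Nat.ListAction using (sum)
open import Data.Bool using (Bool; true; false; not; if_then_else_)
import Data.Bool.Properties as Bool
open import Data.Fin using (Fin)
open import Data.Fin.Properties using (_≟_; any?)
open import Data.List using (List; []; _∷_; [_]; _++_; map; filter; length; allFin; cartesianProduct)
open import Data.List.Properties using (length-map; length-++; length-tabulate; filter-notAll)
open import Data.List.Membership.Propositional using (_∈_)
open import Data.List.Membership.Propositional.Properties
  using (∈-map⁺; ∈-map⁻; ∈-++⁺ˡ; ∈-++⁺ʳ; ∈-++⁻; ∈-cartesianProduct⁺; ∈-filter⁺; ∈-filter⁻; ∈-allFin)
open import Data.List.Relation.Binary.Subset.Propositional using (_⊆_)
import Data.List.Relation.Unary.All as All
open All using ([]; _∷_)
import Data.List.Relation.Unary.Any as Any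
open Any using (here; there)
open import Data.List.Relation.Unary.AllPairs using ([]; _∷_)
open import Data.List.Relation.Unary.Unique.Propositional using (Unique)
import Data.List.Relation.Unary.Unique.Propositional.Properties as Unique
open import Data.Empty using (⊥-elim)
open import Data.Product using (_,_; proj₁; proj₂; ∃; uncurry)
import Data.Product.Properties as Product
open import Data.Sum using (_⊎_; inj₁; inj₂)
import Data.Sum.Properties as Sum
open import Relation.Nullary using (¬_; Dec; yes; no; does)
open import Relation.Nullary.Decidable using (_×-dec_; ¬?; dec-true)
open import Relation.Unary using (Decidable)
open import Relation.Binary.Definitions using (DecidableEquality)
open import Relation.Binary.PropositionalEquality using (_≡_; _≢_; refl; sym; trans; cong; cong₂; subst; module ≡-Reasoning)

-- A duplicate-free list contained in ys is no longer than ys: its head is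
-- in ys, and its tail is contained in the strictly shorter list ys − head.
unique-⊆-length : ∀ {A : Set} → DecidableEquality A →
  ∀ {xs ys : List A} → Unique xs → xs ⊆ ys → length xs ≤ length ys
unique-⊆-length _≟ₐ_ {[]} _ _ = z≤n
unique-⊆-length _≟ₐ_ {x ∷ xs} {ys} (x∉xs ∷ xs-unique) x∷xs⊆ys = begin-strict
    length xs                  ≤⟨ unique-⊆-length _≟ₐ_ xs-unique xs⊆ys-x ⟩
    length (filter ≢x? ys)     <⟨ filter-notAll ≢x? ys (Any.map (λ x≡y y≢x → y≢x (sym x≡y)) (x∷xs⊆ys (here refl))) ⟩
    length ys                  ∎
  where
  open ≤-Reasoning
  ≢x? : Decidable (_≢ x)
  ≢x? y = ¬? (y ≟ₐ x)
  xs⊆ys-x : xs ⊆ filter ≢x? ys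
  xs⊆ys-x y∈xs = ∈-filter⁺ ≢x? (x∷xs⊆ys (there y∈xs)) (λ y≡x → All.lookup x∉xs y∈xs (sym y≡x))

unique-⊆-image-length : ∀ {A B : Set} → DecidableEquality A → (decode : B → A) →
  ∀ {xs : List A} {ys : List B} → Unique xs → xs ⊆ map decode ys → length xs ≤ length ys
unique-⊆-image-length _≟ₐ_ decode {ys = ys} xs-unique xs⊆ =
  subst (_ ≤_) (length-map decode ys) (unique-⊆-length _≟ₐ_ xs-unique xs⊆)

length-cartesianProduct : ∀ {A B : Set} (xs : List A) (ys : List B) →
  length (cartesianProduct xs ys) ≡ length xs * length ys
length-cartesianProduct []       ys = refl
length-cartesianProduct (x ∷ xs) ys = begin
  length (map (x ,_) ys ++ cartesianProduct xs ys)          ≡⟨ length-++ (map (x ,_) ys) ⟩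
  length (map (x ,_) ys) + length (cartesianProduct xs ys)  ≡⟨ cong₂ _+_ (length-map (x ,_) ys) (length-cartesianProduct xs ys) ⟩
  length ys + length xs * length ys                         ∎
  where open ≡-Reasoning

length-allFin : ∀ n → length (allFin n) ≡ n
length-allFin n = length-tabulate {n = n} (λ i → i)

bools : List Bool
bools = false ∷ true ∷ []

bools-complete : ∀ b → b ∈ bools
bools-complete false = here refl
bools-complete true  = there (here refl)

bools-unique : Unique bools
bools-unique = ((λ ()) ∷ []) ∷ [] ∷ []

length-pairs : ∀ k → length (cartesianProduct (allFin k) bools) ≡ k * 2
length-pairs k = trans (length-cartesianProduct (allFin k) bools) (cong (_* 2) (length-allFin k))

Adj-sym : ∀ {n} (G : Graph n) {u v : Fin n} → Adj G u v → Adj G v u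
Adj-sym G {u} {v} uv = trans (adj-sym G v u) uv

Adj-irrefl : ∀ {n} (G : Graph n) {u v : Fin n} → Adj G u v → u ≢ v
Adj-irrefl G {u} uv refl with trans (sym uv) (adj-irrefl G u)
... | ()

Adj? : ∀ {n} (G : Graph n) (v : Fin n) → Decidable (Adj G v)
Adj? G v u = adj G v u Bool.≟ true

neighbours : ∀ {n} → Graph n → Fin n → List (Fin n)
neighbours {n} G v = filter (Adj? G v) (allFin n)

sum-indicator : ∀ {A : Set} (f : A → Bool) (xs : List A) →
  sum (map (λ x → if f x then 1 else 0) xs) ≡ length (filter (λ x → f x Bool.≟ true) xs)
sum-indicator f []       = refl
sum-indicator f (x ∷ xs) with f x
... | true  = cong suc (sum-indicator f xs)
... | false = sum-indicator f xs

degree≡2 : ∀ {n} (G : Graph n) {v x y : Fin n} → x ≢ y → Adj G v x → Adj G v y →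
  (∀ u → Adj G v u → u ≡ x ⊎ u ≡ y) → degree G v ≡ 2
degree≡2 {n} G {v} {x} {y} x≢y vx vy only =
  trans (sum-indicator (adj G v) (allFin n)) (≤-antisym at-most-two at-least-two)
  where
  neighbours-unique : Unique (neighbours G v)
  neighbours-unique = Unique.filter⁺ (Adj? G v) (Unique.allFin⁺ n)
  listed : ∀ {u} → Adj G v u → u ∈ neighbours G v
  listed vu = ∈-filter⁺ (Adj? G v) (∈-allFin _) vu
  at-most-two : length (neighbours G v) ≤ 2
  at-most-two = unique-⊆-length _≟_ neighbours-unique within
    where
    within : neighbours G v ⊆ x ∷ y ∷ []
    within u∈ with only _ (proj₂ (∈-filter⁻ (Adj? G v) {xs = allFin n} u∈))
    ... | inj₁ refl = here refl
    ... | inj₂ refl = there (here refl)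
  at-least-two : 2 ≤ length (neighbours G v)
  at-least-two = unique-⊆-length _≟_ ((x≢y ∷ []) ∷ [] ∷ []) λ where
    (here refl)         → listed vx
    (there (here refl)) → listed vy

-- Routes.  A step is described by two bits (a colour slot and an end of an
-- edge), a route is a list of at most two steps; there are 1 + 4 + 16 = 21.

Step : Set
Step = Bool × Bool

steps : List Step
steps = cartesianProduct bools bools

twoSteps : Step → Step → List Step
twoSteps t t′ = t ∷ t′ ∷ []

routes : List (List Step)
routes = [] ∷ map [_] steps ++ map (uncurry twoSteps) (cartesianProduct steps steps)

steps-complete : ∀ t → t ∈ steps
steps-complete (x , s) = ∈-cartesianProduct⁺ (bools-complete x) (bools-complete s)

route₀ : [] ∈ routes
route₀ = here refl

route₁ : ∀ t → [ t ] ∈ routes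
route₁ t = there (∈-++⁺ˡ (∈-map⁺ [_] (steps-complete t)))

route₂ : ∀ t t′ → twoSteps t t′ ∈ routes
route₂ t t′ = there (∈-++⁺ʳ (map [_] steps)
  (∈-map⁺ (uncurry twoSteps) (∈-cartesianProduct⁺ (steps-complete t) (steps-complete t′))))

module Palettes {n} (G : Graph n) {m} (c : EdgeColoring G m) (two-valid : TwoValid c) where

  rep : Fin m → Bool → Fin n
  rep j false = proj₁ (col-surj c j)
  rep j true  = proj₁ (proj₂ (col-surj c j))

  rep-adj : ∀ j s → Adj G (rep j s) (rep j (not s))
  rep-adj j false = proj₁ (proj₂ (proj₂ (col-surj c j)))
  rep-adj j true  = Adj-sym G (rep-adj j false)

  rep-col : ∀ j s → col c (rep j s) (rep j (not s)) ≡ j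
  rep-col j false = proj₂ (proj₂ (proj₂ (col-surj c j)))
  rep-col j true  = trans (sym (col-sym c _ _ (rep-adj j false))) (rep-col j false)

  -- Which end of the representative edge of j the vertex v is, when it is one.
  side : Fin m → Fin n → Bool
  side j v = not (does (v ≟ rep j false))

  side-rep : ∀ j s → side j (rep j s) ≡ s
  side-rep j false = cong not (dec-true (rep j false ≟ rep j false) refl)
  side-rep j true with rep j true ≟ rep j false
  ... | yes e = ⊥-elim (Adj-irrefl G (rep-adj j true) e)
  ... | no _  = refl

  IsEnd : Fin m → Fin n → Set
  IsEnd j v = rep j (side j v) ≡ v

  isEnd-rep : ∀ j s → IsEnd j (rep j s)
  isEnd-rep j s = cong (rep j) (side-rep j s)

  other : Fin m → Fin n → Fin n
  other j v = rep j (not (side j v))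

  other-adj : ∀ {j v} → IsEnd j v → Adj G v (other j v)
  other-adj {j} {v} end = subst (λ w → Adj G w (other j v)) end (rep-adj j (side j v))

  other-col : ∀ {j v} → IsEnd j v → col c v (other j v) ≡ j
  other-col {j} {v} end = subst (λ w → col c w (other j v) ≡ j) end (rep-col j (side j v))

  other-unique : ∀ {j v u} → IsEnd j v → IsEnd j u → u ≢ v → u ≡ other j v
  other-unique {j} {v} {u} v-end u-end u≢v = begin
    u                      ≡⟨ sym u-end ⟩
    rep j (side j u)       ≡⟨ cong (rep j) (Bool.¬-not sides-differ) ⟩
    rep j (not (side j v)) ∎
    where
    open ≡-Reasoning
    sides-differ : side j u ≢ side j v
    sides-differ same = u≢v (trans (sym u-end) (trans (cong (rep j) same) v-end))

  -- The two colours at v, and the slot holding a given colour (the first if both do).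
  palette : Fin n → Bool → Fin m
  palette v false = proj₁ (two-valid v)
  palette v true  = proj₁ (proj₂ (two-valid v))

  slot : Fin n → Fin m → Bool
  slot v j = not (does (j ≟ palette v false))

  slot-first : ∀ v → slot v (palette v false) ≡ false
  slot-first v = cong not (dec-true (palette v false ≟ palette v false) refl)

  Sees : Fin n → Fin m → Set
  Sees v j = palette v (slot v j) ≡ j

  sees : ∀ {v j} → j ≡ palette v false ⊎ j ≡ palette v true → Sees v j
  sees {v} {j} j∈palette with j ≟ palette v false | j∈palette
  ... | yes j≡a | _        = sym j≡a
  ... | no  j≢a | inj₁ j≡a = ⊥-elim (j≢a j≡a)
  ... | no  _   | inj₂ j≡b = sym j≡b

  sees-edge : ∀ {v u} → Adj G v u → Sees v (col c v u)
  sees-edge {v} {u} vu = sees (proj₂ (proj₂ (two-valid v)) u vu)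

  sees-edge′ : ∀ {u v} → Adj G u v → Sees v (col c u v)
  sees-edge′ {u} {v} uv = subst (Sees v) (col-sym c v u (Adj-sym G uv)) (sees-edge (Adj-sym G uv))

  sees-rep : ∀ j s → Sees (rep j s) j
  sees-rep j s = subst (Sees (rep j s)) (rep-col j s) (sees-edge (rep-adj j s))

  -- Slot s of v is occupied when it is the slot of its colour (so a colour
  -- sitting in both slots occupies only the first) and v is an end of that
  -- colour's representative edge.
  Occupied : Fin n → Bool → Set
  Occupied v s = slot v (palette v s) ≡ s × IsEnd (palette v s) v

  Occupied? : ∀ v s → Dec (Occupied v s)
  Occupied? v s = (slot v (palette v s) Bool.≟ s) ×-dec (rep (palette v s) (side (palette v s) v) ≟ v)

  Full : Fin n → Set
  Full v = Occupied v false × Occupied v true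

  Deficient : Fin n → Set
  Deficient v = ¬ Full v

  Full? : ∀ v → Dec (Full v)
  Full? v = Occupied? v false ×-dec Occupied? v true

  occupied : ∀ {v} → Full v → ∀ s → Occupied v s
  occupied (o , _) false = o
  occupied (_ , o) true  = o

  full-isEnd : ∀ {v j} → Full v → Sees v j → IsEnd j v
  full-isEnd {v} {j} full v-sees-j = subst (λ i → IsEnd i v) v-sees-j (proj₂ (occupied full (slot v j)))

  deficients : List (Fin n)
  deficients = filter (λ v → ¬? (Full? v)) (allFin n)

  decodeSlot : Fin n × Bool → (Fin m × Bool) ⊎ Fin n
  decodeSlot (v , s) with Occupied? v s
  ... | yes _ = inj₁ (palette v s , side (palette v s) v)
  ... | no  _ = inj₂ v

  decode-occupied : ∀ {v s} → Occupied v s → decodeSlot (v , s) ≡ inj₁ (palette v s , side (palette v s) v)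
  decode-occupied {v} {s} o with Occupied? v s
  ... | yes _ = refl
  ... | no ¬o = ⊥-elim (¬o o)

  decode-free : ∀ {v s} → ¬ Occupied v s → decodeSlot (v , s) ≡ inj₂ v
  decode-free {v} {s} ¬o with Occupied? v s
  ... | yes o = ⊥-elim (¬o o)
  ... | no  _ = refl

  incidence-decoded : ∀ j s → decodeSlot (rep j s , slot (rep j s) j) ≡ inj₁ (j , s)
  incidence-decoded j s = begin
    decodeSlot (v , t)                          ≡⟨ decode-occupied (cong (slot v) (sees-rep j s) , isEnd) ⟩
    inj₁ (palette v t , side (palette v t) v)   ≡⟨ cong (λ i → inj₁ (i , side i v)) (sees-rep j s) ⟩
    inj₁ (j , side j v)                         ≡⟨ cong (λ b → inj₁ (j , b)) (side-rep j s) ⟩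
    inj₁ (j , s)                                ∎
    where
    open ≡-Reasoning
    v : Fin n
    v = rep j s
    t : Bool
    t = slot v j
    isEnd : IsEnd (palette v t) v
    isEnd = subst (λ i → IsEnd i v) (sym (sees-rep j s)) (isEnd-rep j s)

  deficient-decoded : ∀ {v} → Deficient v → ∃ λ s → decodeSlot (v , s) ≡ inj₂ v
  deficient-decoded {v} deficient with Occupied? v false
  ... | yes o₀ = true  , decode-free (λ o₁ → deficient (o₀ , o₁))
  ... | no ¬o₀ = false , decode-free ¬o₀

  slots : List (Fin n × Bool)
  slots = cartesianProduct (allFin n) bools

  decoded : ∀ {x} v s → decodeSlot (v , s) ≡ x → x ∈ map decodeSlot slots
  decoded v s refl = ∈-map⁺ decodeSlot (∈-cartesianProduct⁺ (∈-allFin v) (bools-complete s))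

  -- The ends of representative edges, and the deficient vertices: these are
  -- what decodeSlot recovers, so there are at most as many as slots.
  ends : List (Fin m × Bool)
  ends = cartesianProduct (allFin m) bools

  incidences : List ((Fin m × Bool) ⊎ Fin n)
  incidences = map inj₁ ends ++ map inj₂ deficients

  incidences-unique : Unique incidences
  incidences-unique = Unique.++⁺
    (Unique.map⁺ Sum.inj₁-injective (Unique.cartesianProduct⁺ (Unique.allFin⁺ m) bools-unique))
    (Unique.map⁺ Sum.inj₂-injective (Unique.filter⁺ _ (Unique.allFin⁺ n)))
    disjoint
    where
    disjoint : ∀ {x} → ¬ (x ∈ map inj₁ ends × x ∈ map inj₂ deficients)
    disjoint (x∈₁ , x∈₂) with ∈-map⁻ inj₁ x∈₁ | ∈-map⁻ inj₂ x∈₂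
    ... | _ , _ , refl | _ , _ , ()

  incidences-decoded : incidences ⊆ map decodeSlot slots
  incidences-decoded x∈ with ∈-++⁻ (map inj₁ ends) x∈
  ... | inj₁ x∈₁ with ∈-map⁻ inj₁ x∈₁
  ...   | (j , s) , _ , refl = decoded (rep j s) (slot (rep j s) j) (incidence-decoded j s)
  incidences-decoded x∈ | inj₂ x∈₂ with ∈-map⁻ inj₂ x∈₂
  ...   | v , v∈ , refl = uncurry (decoded v) (deficient-decoded (proj₂ (∈-filter⁻ _ {xs = allFin n} v∈)))

  length-incidences : length incidences ≡ m * 2 + length deficients
  length-incidences = begin
    length (map inj₁ ends ++ map inj₂ deficients)          ≡⟨ length-++ (map inj₁ ends) ⟩
    length (map inj₁ ends) + length (map inj₂ deficients)  ≡⟨ cong₂ _+_ (length-map inj₁ ends) (length-map inj₂ deficients) ⟩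
    length ends + length deficients                        ≡⟨ cong (_+ length deficients) (length-pairs m) ⟩
    m * 2 + length deficients                              ∎
    where open ≡-Reasoning

  incidence-count : m * 2 + length deficients ≤ n * 2
  incidence-count = begin
    m * 2 + length deficients  ≡⟨ sym length-incidences ⟩
    length incidences          ≤⟨ unique-⊆-image-length ≡-dec decodeSlot incidences-unique incidences-decoded ⟩
    length slots               ≡⟨ length-pairs n ⟩
    n * 2                      ∎
    where
    open ≤-Reasoning
    ≡-dec : DecidableEquality ((Fin m × Bool) ⊎ Fin n)
    ≡-dec = Sum.≡-dec (Product.≡-dec _≟_ Bool._≟_) _≟_

  step : Fin n → Step → Fin n
  step w (x , s) = rep (palette w x) s

  walk : Fin n → List Step → Fin n
  walk w []      = w
  walk w (t ∷ r) = walk (step w t) r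

  code : Fin n → Fin n → Step
  code u v = slot u (col c u v) , side (col c u v) v

  step-code : ∀ {u v} → Adj G u v → Full v → step u (code u v) ≡ v
  step-code {u} {v} uv full = begin
    rep (palette u (slot u j)) (side j v) ≡⟨ cong (λ i → rep i (side j v)) (sees-edge uv) ⟩
    rep j (side j v)                      ≡⟨ full-isEnd full (sees-edge′ uv) ⟩
    v                                     ∎
    where
    open ≡-Reasoning
    j : Fin m
    j = col c u v

  reachable : List (Fin n)
  reachable = map (uncurry walk) (cartesianProduct deficients routes)

  reached : ∀ {d r v} → Deficient d → r ∈ routes → walk d r ≡ v → v ∈ reachable
  reached {d} {r} deficient r∈ refl =
    ∈-map⁺ (uncurry walk) (∈-cartesianProduct⁺ (∈-filter⁺ _ (∈-allFin d) deficient) r∈)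

  partner : Fin n → Bool → Fin n
  partner v s = other (palette v s) v

  partner-adj : ∀ {v} → Full v → ∀ s → Adj G v (partner v s)
  partner-adj full s = other-adj (proj₂ (occupied full s))

  partner-col : ∀ {v} → Full v → ∀ s → col c v (partner v s) ≡ palette v s
  partner-col full s = other-col (proj₂ (occupied full s))

  partners-differ : ∀ {v} → Full v → partner v false ≢ partner v true
  partners-differ {v} full same = false≢true (begin
    false                      ≡⟨ sym (slot-first v) ⟩
    slot v (palette v false)   ≡⟨ cong (slot v) colours-equal ⟩
    slot v (palette v true)    ≡⟨ proj₁ (occupied full true) ⟩
    true                       ∎)
    where
    open ≡-Reasoning
    false≢true : false ≢ true
    false≢true ()
    colours-equal : palette v false ≡ palette v true
    colours-equal = trans (sym (partner-col full false)) (trans (cong (col c v) same) (partner-col full true))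

  Stray : Fin n → Fin n → Set
  Stray v u = Adj G v u × u ≢ partner v false × u ≢ partner v true

  Stray? : ∀ v u → Dec (Stray v u)
  Stray? v u = Adj? G v u ×-dec (¬? (u ≟ partner v false) ×-dec ¬? (u ≟ partner v true))

  -- A stray neighbour of a full vertex is deficient: were it full, the edge
  -- would be the representative edge of its colour, making it a partner.
  stray-deficient : ∀ {v u} → Full v → Stray v u → Deficient u
  stray-deficient {v} {u} v-full (vu , u≢p₀ , u≢p₁) u-full = not-partner (slot v j) u≡partner
    where
    j : Fin m
    j = col c v u
    u≡partner : u ≡ partner v (slot v j)
    u≡partner = trans
      (other-unique (full-isEnd v-full (sees-edge vu)) (full-isEnd u-full (sees-edge′ vu)) (λ u≡v → Adj-irrefl G vu (sym u≡v)))
      (cong (λ i → other i v) (sym (sees-edge vu)))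
    not-partner : ∀ s → u ≢ partner v s
    not-partner false = u≢p₀
    not-partner true  = u≢p₁

  no-stray-degree : ∀ {v} → Full v → (∀ u → ¬ Stray v u) → degree G v ≡ 2
  no-stray-degree {v} full no-stray =
    degree≡2 G (partners-differ full) (partner-adj full false) (partner-adj full true) only
    where
    only : ∀ u → Adj G v u → u ≡ partner v false ⊎ u ≡ partner v true
    only u vu with u ≟ partner v false | u ≟ partner v true
    ... | yes u≡p₀ | _        = inj₁ u≡p₀
    ... | no  _    | yes u≡p₁ = inj₂ u≡p₁
    ... | no  u≢p₀ | no  u≢p₁ = ⊥-elim (no-stray u (vu , u≢p₀ , u≢p₁))

  -- A full vertex of degree 2 is reached through its neighbour w: either w is
  -- deficient, or w has a deficient stray neighbour, or w has degree 2 too.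
  reached-through : NoAdjacentDeg2 G → ∀ {v w} → Full v → (∀ u → ¬ Stray v u) → Adj G v w → v ∈ reachable
  reached-through no-deg2-pair {v} {w} v-full v-no-stray vw with Full? w
  ... | no w-deficient = reached w-deficient (route₁ (code w v)) (step-code (Adj-sym G vw) v-full)
  ... | yes w-full with any? (Stray? w)
  ...   | yes (u , u-stray) = reached (stray-deficient w-full u-stray) (route₂ (code u w) (code w v))
          (trans (cong (λ x → step x (code w v)) (step-code (Adj-sym G (proj₁ u-stray)) w-full)) (step-code (Adj-sym G vw) v-full))
  ...   | no w-no-stray = ⊥-elim (no-deg2-pair v w vw (no-stray-degree v-full v-no-stray)
                                   (no-stray-degree w-full (λ u u-stray → w-no-stray (u , u-stray))))

  every-vertex-reached : NoAdjacentDeg2 G → ∀ v → v ∈ reachable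
  every-vertex-reached no-deg2-pair v with Full? v
  ... | no deficient = reached deficient route₀ refl
  ... | yes full with any? (Stray? v)
  ...   | yes (u , u-stray) = reached (stray-deficient full u-stray) (route₁ (code u v)) (step-code (Adj-sym G (proj₁ u-stray)) full)
  ...   | no no-stray = reached-through no-deg2-pair full (λ u u-stray → no-stray (u , u-stray)) (partner-adj full false)

  vertex-count : NoAdjacentDeg2 G → n ≤ length deficients * 21
  vertex-count no-deg2-pair = begin
    n                                            ≡⟨ sym (length-allFin n) ⟩
    length (allFin n)                            ≤⟨ unique-⊆-image-length _≟_ (uncurry walk) (Unique.allFin⁺ n) (λ {v} _ → every-vertex-reached no-deg2-pair v) ⟩
    length (cartesianProduct deficients routes)  ≡⟨ length-cartesianProduct deficients routes ⟩
    length deficients * 21                       ∎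
    where open ≤-Reasoning

linear-bound : ∀ k n m D → m * 2 + D ≤ n * 2 → n ≤ D * 21 → n ∸ k ≤ m → n ≤ 42 * k
linear-bound k n m D incidences vertices n∸k≤m = begin
  n           ≤⟨ vertices ⟩
  D * 21      ≤⟨ *-monoˡ-≤ 21 D≤2k ⟩
  k * 2 * 21  ≡⟨ trans (*-assoc k 2 21) (*-comm k 42) ⟩
  42 * k      ∎
  where
  open ≤-Reasoning
  n≤k+m : n ≤ k + m
  n≤k+m = ≤-trans (m≤n+m∸n n k) (+-monoʳ-≤ k n∸k≤m)
  D≤2k : D ≤ k * 2
  D≤2k = +-cancelˡ-≤ (m * 2) D (k * 2) (begin
    m * 2 + D     ≤⟨ incidences ⟩
    n * 2         ≤⟨ *-monoˡ-≤ 2 n≤k+m ⟩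
    (k + m) * 2   ≡⟨ *-distribʳ-+ 2 k m ⟩
    k * 2 + m * 2 ≡⟨ +-comm (k * 2) (m * 2) ⟩
    m * 2 + k * 2 ∎)

mainTheorem2 : Σ ℕ λ C → ∀ (k n : ℕ) (G : Graph n) → (Σ ℕ λ m → (n ∸ k ≤ m) × (Σ (EdgeColoring G m) λ c → TwoValid c)) → NoAdjacentDeg2 G → n ≤ C * k
mainTheorem2 = 42 , λ where
  k n G (m , n∸k≤m , c , two-valid) no-deg2-pair →
    let open Palettes G c two-valid
    in linear-bound k n m (length deficients) incidence-count (vertex-count no-deg2-pair) n∸k≤m
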